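{- Let $\mathcal{C}$ be a caterpillar graph whose vertices $0,1,\dots,n$ form a path of maximum length (edges $\{t,t+1\}$), all other vertices being pendant vertices adjacent to path vertices. Let $X=\{\{0,\alpha\}:\alpha\neq 0\}\cup\{\{\alpha,n\}:\deg(\alpha)\neq1\}$. Let $\{k,j\}\notin X$ with $0<k\le n$ and $j>n$ (so $j$ is not on the path), let $i$ be the path vertex adjacent to $j$, and suppose $k\ge i$. Then for every $2$-element subset $Y$ of the vertex set of $\mathcal{C}$, \[d_{\mathcal{C}}(Y\cup\{k,j\})=d_{\mathcal{C}}(Y\cup\{0,j\})-d_{\mathcal{C}}(Y\cup\{0,n\})+d_{\mathcal{C}}(Y\cup\{i,n\})+d_{\mathcal{C}}(Y\cup\{0,k\})-d_{\mathcal{C}}(Y\cup\{0,i\}),\] i.e. the column of $D_2(\mathcal{C})$ indexed by $\{k,j\}$ equals the corresponding combination of the columns indexed by $\{0,j\},\{0,n\},\{i,n\},\{0,k\},\{0,i\}$.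
   Context: A caterpillar graph is a tree in which every vertex is within distance $1$ of a central path. The vertices not on the path are labelled by integers greater than $n$. For a connected graph $G$ and a vertex set $Y$ with $|Y|\ge 2$, the Steiner distance $d_G(Y)$ is the minimum number of edges among all connected subgraphs of $G$ whose vertex set contains $Y$. The $2$-Steiner distance matrix $D_2(G)$ has rows and columns indexed by $2$-element vertex subsets, with $(X_1,X_2)$-entry $d_G(X_1\cup X_2)$. -}

module Defs where

open import Data.Nat using (ℕ; zero; suc; _+_; _≤_; _≡ᵇ_)
open import Data.Bool using (if_then_else_)
open import Data.Fin using (Fin; toℕ)
open import Data.List using (List; []; _∷_; map; upTo; allFin; _++_; length)
open import Data.Nat.ListAction using (sum)
open import Data.List.Membership.Propositional using (_∈_)
open import Data.List.Relation.Unary.All using (All)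
open import Data.List.Relation.Unary.Unique.Propositional using (Unique)
open import Data.List.Relation.Unary.Linked using (Linked)
open import Data.Product using (Σ; _×_; _,_; proj₁; proj₂)
open import Data.Sum using (_⊎_)
open import Relation.Binary.PropositionalEquality using (_≡_; _≢_)

Edge : Set
Edge = ℕ × ℕ

-- The caterpillar C(n, m, att): path vertices 0,1,…,n with edges {t,t+1};
-- m pendant vertices labelled n+1, …, n+m, the pendant n+1+p adjacent to
-- the path vertex att p (assumed ≤ n in the theorem).
pathEdges : ℕ → List Edge
pathEdges n = map (λ t → (t , suc t)) (upTo n)

pendEdges : (n m : ℕ) → (Fin m → ℕ) → List Edge
pendEdges n m att = map (λ p → (att p , n + suc (toℕ p))) (allFin m)

catEdges : (n m : ℕ) → (Fin m → ℕ) → List Edge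
catEdges n m att = pathEdges n ++ pendEdges n m att

IsVertex : (n m : ℕ) → ℕ → Set
IsVertex n m v = v ≤ n + m

Adj : List Edge → ℕ → ℕ → Set
Adj Es u v = (u , v) ∈ Es ⊎ (v , u) ∈ Es

deg : List Edge → ℕ → ℕ
deg Es α = sum (map (λ e → (if proj₁ e ≡ᵇ α then 1 else 0) + (if proj₂ e ≡ᵇ α then 1 else 0)) Es)

IsPath : (n m : ℕ) → (Fin m → ℕ) → List ℕ → Set
IsPath n m att ps = Unique ps × All (IsVertex n m) ps × Linked (Adj (catEdges n m att)) ps

data Reach (Es : List Edge) : ℕ → ℕ → Set where
  here : ∀ {u} → Reach Es u u
  step : ∀ {u w v} → Adj Es u w → Reach Es w v → Reach Es u v

ConnSub : (n m : ℕ) → (Fin m → ℕ) → List ℕ → ℕ → Set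
ConnSub n m att S ℓ =
  Σ (List ℕ) λ Vs → Σ (List Edge) λ Es →
    All (IsVertex n m) Vs ×
    Unique Es ×
    All (_∈ catEdges n m att) Es ×
    All (λ e → proj₁ e ∈ Vs × proj₂ e ∈ Vs) Es ×
    (∀ u v → u ∈ Vs → v ∈ Vs → Reach Es u v) ×
    All (_∈ Vs) S ×
    length Es ≡ ℓ

SteinerDist : (n m : ℕ) → (Fin m → ℕ) → List ℕ → ℕ → Set
SteinerDist n m att S d = ConnSub n m att S d × (∀ ℓ → ConnSub n m att S ℓ → d ≤ ℓ)

InX : (n m : ℕ) → (Fin m → ℕ) → ℕ → ℕ → Set
InX n m att a b =
  (a ≡ 0 × b ≢ 0) ⊎ (b ≡ 0 × a ≢ 0) ⊎
  (b ≡ n × a ≢ n × deg (catEdges n m att) a ≢ 1) ⊎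
  (a ≡ n × b ≢ n × deg (catEdges n m att) b ≢ 1)

{-# OPTIONS --safe #-}
-- Project every vertex onto the spine (a pendant vertex onto its neighbour).
-- For a vertex set S with two distinct elements, every connected subgraph
-- containing S must use each spine edge {t, t+1} between the least and the
-- greatest projection of S (a walk between those two vertices has to cross
-- it) and the edge of each pendant vertex of S (a leaf that has to be joined
-- to another vertex of S).  These edges form such a subgraph themselves, so
--   d(S) = max π(S) − min π(S) + #(pendant vertices in S).
-- In the six distances of the theorem the pendant counts agree pairwise,
-- and with X = max π(y₁, y₂, k) and c = min π(y₁, y₂, i) the identity
-- reduces to (X ∸ c) + n = (n ∸ c) + X, valid because c ≤ i ≤ k ≤ X and c ≤ n.
module Submission where

open import Defs
open import Data.Nat
  using (ℕ; zero; suc; _+_; _∸_; _≤_; _<_; _≤?_; _≟_; z≤n; s≤s; _⊔_; _⊓_)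
open import Data.Nat.Properties
import Data.Nat.Solver as ℕ-Solver
open import Data.Fin using (Fin; toℕ; fromℕ<) renaming (zero to fzero; suc to fsuc)
open import Data.Fin.Properties using (toℕ-injective; toℕ-fromℕ<; toℕ<n)
open import Data.List using (List; []; _∷_; length; map; upTo; allFin; _++_; filter; applyUpTo)
open import Data.List.Properties using (length-++; length-map; length-applyUpTo; filter-≐)
open import Data.List.Membership.Propositional using (_∈_)
open import Data.List.Membership.Propositional.Properties
open import Data.List.Membership.DecPropositional _≟_ using (_∈?_)
open import Data.List.Relation.Binary.Subset.Propositional using (_⊆_)
open import Data.List.Relation.Unary.Any using (here; there)
open import Data.List.Relation.Unary.All as All using (All; []; _∷_)
import Data.List.Relation.Unary.All.Properties as All
open import Data.List.Relation.Unary.AllPairs using ([]; _∷_)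
open import Data.List.Relation.Unary.Unique.Propositional using (Unique)
import Data.List.Relation.Unary.Unique.Propositional.Properties as Unique
open import Data.Integer using (+_; _-_) renaming (_+_ to _+ℤ_)
import Data.Integer.Properties as ℤ
import Data.Integer.Solver as ℤ-Solver
open import Data.Product using (∃-syntax; _×_; _,_; proj₁; proj₂)
open import Data.Sum using (_⊎_; inj₁; inj₂; [_,_]′)
open import Function using (_∘_)
open import Relation.Nullary using (¬_; yes; no; contradiction)
open import Relation.Binary.PropositionalEquality

module _ {A : Set} where

  ∈-remove : ∀ {x : A} {ys} → x ∈ ys →
    ∃[ ys′ ] length ys ≡ suc (length ys′) × (∀ {z} → z ∈ ys → z ≢ x → z ∈ ys′)
  ∈-remove {ys = _ ∷ ys} (here refl) =
    ys , refl , λ { (here refl) z≢x → contradiction refl z≢x ; (there z∈) _ → z∈ }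
  ∈-remove {ys = y ∷ _} (there x∈) with ys′ , len , keep ← ∈-remove x∈ =
    y ∷ ys′ , cong suc len , λ { (here refl) _ → here refl ; (there z∈) z≢x → there (keep z∈ z≢x) }

  Unique-⊆⇒length≤ : ∀ {xs ys : List A} → Unique xs → xs ⊆ ys → length xs ≤ length ys
  Unique-⊆⇒length≤ {[]} _ _ = z≤n
  Unique-⊆⇒length≤ {x ∷ xs} (x∉xs ∷ xs!) xs⊆ys
    with ys′ , len , keep ← ∈-remove (xs⊆ys (here refl)) =
    subst (suc (length xs) ≤_) (sym len)
      (s≤s (Unique-⊆⇒length≤ xs! λ z∈ → keep (xs⊆ys (there z∈)) λ { refl → All.lookup x∉xs z∈ refl }))

  ∈-++-replace : ∀ xs {ys} {x a b : A} → x ≢ a → x ∈ xs ++ a ∷ ys → x ∈ xs ++ b ∷ ys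
  ∈-++-replace []       x≢a (here x≡a) = contradiction x≡a x≢a
  ∈-++-replace []       _   (there x∈) = there x∈
  ∈-++-replace (_ ∷ _)  _   (here x≡y) = here x≡y
  ∈-++-replace (_ ∷ xs) x≢a (there x∈) = there (∈-++-replace xs x≢a x∈)

m<n∸o⇒o+m<n : ∀ o {m n} → m < n ∸ o → o + m < n
m<n∸o⇒o+m<n o {m} {n} m<n∸o = subst (o + m <_) (m+[n∸m]≡n o≤n) (+-monoʳ-< o m<n∸o)
  where
  o≤n : o ≤ n
  o≤n = <⇒≤ (m∸n≢0⇒n<m λ n∸o≡0 → n≮0 (subst (m <_) n∸o≡0 m<n∸o))

Adj-sym : ∀ {Es u v} → Adj Es u v → Adj Es v u
Adj-sym (inj₁ e∈) = inj₂ e∈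
Adj-sym (inj₂ e∈) = inj₁ e∈

Reach-trans : ∀ {Es u v w} → Reach Es u v → Reach Es v w → Reach Es u w
Reach-trans here         r′ = r′
Reach-trans (step u~w r) r′ = step u~w (Reach-trans r r′)

Reach-sym : ∀ {Es u v} → Reach Es u v → Reach Es v u
Reach-sym here         = here
Reach-sym (step u~w r) = Reach-trans (Reach-sym r) (step (Adj-sym u~w) here)

Reach-mono : ∀ {Es Es′ u v} → Es ⊆ Es′ → Reach Es u v → Reach Es′ u v
Reach-mono Es⊆ here                 = here
Reach-mono Es⊆ (step (inj₁ e∈) r)   = step (inj₁ (Es⊆ e∈)) (Reach-mono Es⊆ r)
Reach-mono Es⊆ (step (inj₂ e∈) r)   = step (inj₂ (Es⊆ e∈)) (Reach-mono Es⊆ r)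

Reach-first : ∀ {Es u v} → Reach Es u v → u ≢ v → ∃[ w ] Adj Es u w
Reach-first here                 u≢u = contradiction refl u≢u
Reach-first (step {w = w} u~w _) _   = w , u~w

Connected : List Edge → List ℕ → Set
Connected Es S = ∀ {u v} → u ∈ S → v ∈ S → Reach Es u v

spineEdge : ℕ → Edge
spineEdge t = (t , suc t)

spineEdges : ℕ → ℕ → List Edge
spineEdges a b = applyUpTo (λ x → spineEdge (a + x)) (b ∸ a)

spineSegment : ℕ → ℕ → List ℕ
spineSegment a b = applyUpTo (λ x → a + x) (suc (b ∸ a))

All-spineEdges⁺ : ∀ {P : Edge → Set} {a b} →
  (∀ {t} → a ≤ t → t < b → P (spineEdge t)) → All P (spineEdges a b)
All-spineEdges⁺ {a = a} {b} P-spine =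
  All.applyUpTo⁺₁ _ (b ∸ a) λ x<b∸a → P-spine (m≤m+n a _) (m<n∸o⇒o+m<n a x<b∸a)

∈-spineEdges⁺ : ∀ {a b t} → a ≤ t → t < b → spineEdge t ∈ spineEdges a b
∈-spineEdges⁺ {a} a≤t t<b =
  subst (λ s → spineEdge s ∈ _) (m+[n∸m]≡n a≤t) (∈-applyUpTo⁺ _ (∸-monoˡ-< t<b a≤t))

spineEdges-unique : ∀ a b → Unique (spineEdges a b)
spineEdges-unique a b = Unique.applyUpTo⁺₁ _ (b ∸ a)
  λ x<y _ same → <⇒≢ x<y (+-cancelˡ-≡ a _ _ (cong proj₁ same))

spineEdges-reach : ∀ {a b} v → a ≤ v → v ≤ b → Reach (spineEdges a b) v a
spineEdges-reach v a≤v v≤b with m≤n⇒m<n∨m≡n a≤v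
... | inj₂ refl = here
spineEdges-reach (suc v) _ v<b | inj₁ (s≤s a≤v) =
  step (inj₂ (∈-spineEdges⁺ a≤v v<b)) (spineEdges-reach v a≤v (<⇒≤ v<b))

All-spineSegment⁺ : ∀ {P : ℕ → Set} {a b} → a ≤ b →
  (∀ {v} → a ≤ v → v ≤ b → P v) → All P (spineSegment a b)
All-spineSegment⁺ {a = a} {b} a≤b P-between =
  All.applyUpTo⁺₁ (λ x → a + x) (suc (b ∸ a)) λ { {x} (s≤s x≤b∸a) →
    P-between (m≤m+n a x) (subst (a + x ≤_) (m+[n∸m]≡n a≤b) (+-monoʳ-≤ a x≤b∸a)) }

∈-spineSegment⁺ : ∀ {a b v} → a ≤ v → v ≤ b → v ∈ spineSegment a b
∈-spineSegment⁺ {a} a≤v v≤b =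
  subst (_∈ _) (m+[n∸m]≡n a≤v) (∈-applyUpTo⁺ (λ x → a + x) (s≤s (∸-monoˡ-≤ a v≤b)))

-- Junk value 0 at arguments ≥ m.
extend : ∀ {m} → (Fin m → ℕ) → ℕ → ℕ
extend {zero}  _ _       = 0
extend {suc m} f zero    = f fzero
extend {suc m} f (suc q) = extend (f ∘ fsuc) q

extend-toℕ : ∀ {m} (f : Fin m → ℕ) p → extend f (toℕ p) ≡ f p
extend-toℕ f fzero    = refl
extend-toℕ f (fsuc p) = extend-toℕ (f ∘ fsuc) p

extend-≤ : ∀ {m n} (f : Fin m → ℕ) → (∀ p → f p ≤ n) → ∀ q → extend f q ≤ n
extend-≤ {zero}  _ _   _       = z≤n
extend-≤ {suc m} f f≤n zero    = f≤n fzero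
extend-≤ {suc m} f f≤n (suc q) = extend-≤ (f ∘ fsuc) (f≤n ∘ fsuc) q

-- The number of spine edges needed to join the spine interval [A, B] with
-- the spine vertices a and b.
extent : (A B a b : ℕ) → ℕ
extent A B a b = (B ⊔ (a ⊔ b)) ∸ (A ⊓ (a ⊓ b))

extent-exchange : ∀ A B {i k n} → i ≤ k → k ≤ n → B ≤ n →
  extent A B k i + extent A B 0 n ≡ extent A B i n + extent A B 0 k
extent-exchange A B {i} {k} {n} i≤k k≤n B≤n = begin
  extent A B k i + extent A B 0 n  ≡⟨ cong₂ _+_ extent-ki (trans extent-0 (m≤n⇒m⊔n≡n B≤n)) ⟩
  X ∸ c + n                        ≡⟨ +-∸-comm n c≤X ⟨
  (X + n) ∸ c                      ≡⟨ cong (_∸ c) (+-comm X n) ⟩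
  (n + X) ∸ c                      ≡⟨ +-∸-comm X c≤n ⟩
  n ∸ c + X                        ≡⟨ cong₂ _+_ extent-in extent-0 ⟨
  extent A B i n + extent A B 0 k  ∎
  where
  open ≡-Reasoning
  X = B ⊔ k
  c = A ⊓ i
  i≤n = ≤-trans i≤k k≤n
  c≤X : c ≤ X
  c≤X = ≤-trans (m⊓n≤n A i) (≤-trans i≤k (m≤n⊔m B k))
  c≤n : c ≤ n
  c≤n = ≤-trans (m⊓n≤n A i) i≤n
  extent-ki : extent A B k i ≡ X ∸ c
  extent-ki = cong₂ (λ x y → (B ⊔ x) ∸ (A ⊓ y)) (m≥n⇒m⊔n≡m i≤k) (m≥n⇒m⊓n≡n i≤k)
  extent-in : extent A B i n ≡ n ∸ c
  extent-in = cong₂ (λ x y → x ∸ (A ⊓ y))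
    (trans (cong (B ⊔_) (m≤n⇒m⊔n≡n i≤n)) (m≤n⇒m⊔n≡n B≤n)) (m≤n⇒m⊓n≡m i≤n)
  extent-0 : ∀ {x} → extent A B 0 x ≡ B ⊔ x
  extent-0 {x} = cong ((B ⊔ x) ∸_) (⊓-zeroʳ A)

balance⇒ℤ-combination : ∀ {d₁ d₂ d₃ d₄ d₅ d₆} → d₁ + d₃ + d₆ ≡ d₂ + d₄ + d₅ →
  + d₁ ≡ ((((+ d₂ - + d₃) +ℤ + d₄) +ℤ + d₅) - + d₆)
balance⇒ℤ-combination {d₁} {d₂} {d₃} {d₄} {d₅} {d₆} balance = begin
  + d₁                                      ≡⟨ cancel (+ d₁) (+ d₃) (+ d₆) ⟩
  ((+ d₁ +ℤ + d₃) +ℤ + d₆) - + d₃ - + d₆    ≡⟨ cong (λ x → x - + d₃ - + d₆) balanceℤ ⟩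
  ((+ d₂ +ℤ + d₄) +ℤ + d₅) - + d₃ - + d₆    ≡⟨ regroup (+ d₂) (+ d₃) (+ d₄) (+ d₅) (+ d₆) ⟩
  (((+ d₂ - + d₃) +ℤ + d₄) +ℤ + d₅) - + d₆  ∎
  where
  open ≡-Reasoning
  open ℤ-Solver.+-*-Solver
  cancel : ∀ a c f → a ≡ ((a +ℤ c) +ℤ f) - c - f
  cancel = solve 3 (λ a c f → a := ((a :+ c) :+ f) :- c :- f) refl
  regroup : ∀ b c d e f → ((b +ℤ d) +ℤ e) - c - f ≡ (((b - c) +ℤ d) +ℤ e) - f
  regroup = solve 5 (λ b c d e f → ((b :+ d) :+ e) :- c :- f := (((b :- c) :+ d) :+ e) :- f) refl
  pos-+₃ : ∀ a b c → + (a + b + c) ≡ (+ a +ℤ + b) +ℤ + c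
  pos-+₃ a b c = trans (ℤ.pos-+ (a + b) c) (cong (_+ℤ + c) (ℤ.pos-+ a b))
  balanceℤ : (+ d₁ +ℤ + d₃) +ℤ + d₆ ≡ (+ d₂ +ℤ + d₄) +ℤ + d₅
  balanceℤ = trans (sym (pos-+₃ d₁ d₃ d₆)) (trans (cong +_ balance) (pos-+₃ d₂ d₄ d₅))

column-combination : ∀ {d₁ d₂ d₃ d₄ d₅ d₆ σ₁ σ₃ σ₄ σ₅ τ c c′ : ℕ} →
  d₁ ≡ σ₁ + c′ → d₂ ≡ τ + c′ → d₃ ≡ σ₃ + c → d₄ ≡ σ₄ + c → d₅ ≡ σ₅ + c → d₆ ≡ τ + c →
  σ₁ + σ₃ ≡ σ₄ + σ₅ → + d₁ ≡ ((((+ d₂ - + d₃) +ℤ + d₄) +ℤ + d₅) - + d₆)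
column-combination {σ₁ = σ₁} {σ₃} {σ₄} {σ₅} {τ} {c} {c′} refl refl refl refl refl refl σ-balance =
  balance⇒ℤ-combination (begin
    (σ₁ + c′) + (σ₃ + c) + (τ + c)  ≡⟨ gather σ₁ σ₃ τ c c′ ⟩
    (σ₁ + σ₃) + (τ + c′ + c + c)    ≡⟨ cong (_+ (τ + c′ + c + c)) σ-balance ⟩
    (σ₄ + σ₅) + (τ + c′ + c + c)    ≡⟨ spread σ₄ σ₅ τ c c′ ⟩
    (τ + c′) + (σ₄ + c) + (σ₅ + c)  ∎)
  where
  open ≡-Reasoning
  open ℕ-Solver.+-*-Solver
  gather : ∀ p q t x x′ → (p + x′) + (q + x) + (t + x) ≡ (p + q) + (t + x′ + x + x)
  gather = solve 5 (λ p q t x x′ → (p :+ x′) :+ (q :+ x) :+ (t :+ x) := (p :+ q) :+ (t :+ x′ :+ x :+ x)) refl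
  spread : ∀ p q t x x′ → (p + q) + (t + x′ + x + x) ≡ (t + x′) + (p + x) + (q + x)
  spread = solve 5 (λ p q t x x′ → (p :+ q) :+ (t :+ x′ :+ x :+ x) := (t :+ x′) :+ (p :+ x) :+ (q :+ x)) refl

module Caterpillar (n m : ℕ) (att : Fin m → ℕ) (att≤n : ∀ p → att p ≤ n) where

  E : List Edge
  E = catEdges n m att

  pendant : Fin m → ℕ
  pendant p = n + suc (toℕ p)

  pendantEdge : Fin m → Edge
  pendantEdge p = (att p , pendant p)

  -- Projection onto the spine; arbitrary beyond the last vertex n + m.
  proj : ℕ → ℕ
  proj v with v ≤? n
  ... | yes _ = v
  ... | no  _ = extend att (v ∸ suc n)

  proj-spine : ∀ {v} → v ≤ n → proj v ≡ v
  proj-spine {v} v≤n with v ≤? n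
  ... | yes _   = refl
  ... | no v≰n = contradiction v≤n v≰n

  proj≤n : ∀ v → proj v ≤ n
  proj≤n v with v ≤? n
  ... | yes v≤n = v≤n
  ... | no  _   = extend-≤ att att≤n _

  n<pendant : ∀ p → n < pendant p
  n<pendant p = m<m+n n (s≤s z≤n)

  pendant-vertex : ∀ p → IsVertex n m (pendant p)
  pendant-vertex p = +-monoʳ-≤ n (toℕ<n p)

  pendant≢spine : ∀ {p a} → a ≤ n → pendant p ≢ a
  pendant≢spine {p} a≤n refl = <⇒≱ (n<pendant p) a≤n

  pendant-injective : ∀ {p q} → pendant p ≡ pendant q → p ≡ q
  pendant-injective eq = toℕ-injective (suc-injective (+-cancelˡ-≡ n _ _ eq))

  proj-pendant : ∀ p → proj (pendant p) ≡ att p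
  proj-pendant p with pendant p ≤? n
  ... | yes p≤n = contradiction p≤n (<⇒≱ (n<pendant p))
  ... | no  _   = trans (cong (extend att) index) (extend-toℕ att p)
    where
    index : pendant p ∸ suc n ≡ toℕ p
    index = trans (cong (_∸ suc n) (+-suc n (toℕ p))) (m+n∸m≡n (suc n) (toℕ p))

  vertex-cases : ∀ {v} → IsVertex n m v → v ≤ n ⊎ ∃[ p ] pendant p ≡ v
  vertex-cases {v} v≤n+m with v ≤? n
  ... | yes v≤n = inj₁ v≤n
  ... | no  v≰n = inj₂ (fromℕ< q<m , trans (cong (λ x → n + suc x) (toℕ-fromℕ< q<m)) n+1+q≡v)
    where
    q = v ∸ suc n
    n+1+q≡v : n + suc q ≡ v
    n+1+q≡v = trans (+-suc n q) (m+[n∸m]≡n (≰⇒> v≰n))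
    q<m : q < m
    q<m = +-cancelˡ-≤ n _ _ (subst (_≤ n + m) (sym n+1+q≡v) v≤n+m)

  spineEdge∈E : ∀ {t} → t < n → spineEdge t ∈ E
  spineEdge∈E t<n = ∈-++⁺ˡ (∈-map⁺ spineEdge (∈-upTo⁺ t<n))

  pendantEdge∈E : ∀ p → pendantEdge p ∈ E
  pendantEdge∈E p = ∈-++⁺ʳ (pathEdges n) (∈-map⁺ pendantEdge (∈-allFin p))

  ∈E-cases : ∀ {e} → e ∈ E → (∃[ t ] t < n × e ≡ spineEdge t) ⊎ (∃[ p ] e ≡ pendantEdge p)
  ∈E-cases e∈E with ∈-++⁻ (pathEdges n) e∈E
  ... | inj₁ e∈ with t , t∈ , refl ← ∈-map⁻ spineEdge e∈ = inj₁ (t , ∈-upTo⁻ t∈ , refl)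
  ... | inj₂ e∈ with p , _ , refl ← ∈-map⁻ pendantEdge e∈ = inj₂ (p , refl)

  ∈E⇒tail≤n : ∀ {e} → e ∈ E → proj₁ e ≤ n
  ∈E⇒tail≤n e∈E with ∈E-cases e∈E
  ... | inj₁ (_ , t<n , refl) = <⇒≤ t<n
  ... | inj₂ (p , refl)       = att≤n p

  ∈E⇒proj-mono : ∀ {e} → e ∈ E → proj (proj₁ e) ≤ proj (proj₂ e)
  ∈E⇒proj-mono e∈E with ∈E-cases e∈E
  ... | inj₁ (t , t<n , refl) rewrite proj-spine (<⇒≤ t<n) | proj-spine t<n = n≤1+n t
  ... | inj₂ (p , refl)       rewrite proj-spine (att≤n p) | proj-pendant p = ≤-refl

  ∈E-crossing : ∀ {e t} → e ∈ E → proj (proj₁ e) ≤ t → t < proj (proj₂ e) → e ≡ spineEdge t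
  ∈E-crossing e∈E s≤t t<s+1 with ∈E-cases e∈E
  ... | inj₁ (s , s<n , refl) rewrite proj-spine (<⇒≤ s<n) | proj-spine s<n =
    cong spineEdge (≤-antisym s≤t (≤-pred t<s+1))
  ... | inj₂ (p , refl) rewrite proj-spine (att≤n p) | proj-pendant p =
    contradiction s≤t (<⇒≱ t<s+1)

  ∈E-pendantHead : ∀ {e p} → e ∈ E → proj₂ e ≡ pendant p → e ≡ pendantEdge p
  ∈E-pendantHead e∈E head≡ with ∈E-cases e∈E
  ... | inj₁ (_ , t<n , refl) = contradiction (sym head≡) (pendant≢spine t<n)
  ... | inj₂ (q , refl)       = cong pendantEdge (pendant-injective head≡)

  Reach-crossing : ∀ {Es u v t} → All (_∈ E) Es → Reach Es u v →
    proj u ≤ t → t < proj v → spineEdge t ∈ Es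
  Reach-crossing _ here u≤t t<u = contradiction u≤t (<⇒≱ t<u)
  Reach-crossing {t = t} Es⊆E (step {w = w} u~w r) u≤t t<v with proj w ≤? t
  ... | yes w≤t = Reach-crossing Es⊆E r w≤t t<v
  ... | no  w≰t with u~w
  ...   | inj₁ e∈ = subst (_∈ _) (∈E-crossing (All.lookup Es⊆E e∈) u≤t (≰⇒> w≰t)) e∈
  ...   | inj₂ e∈ = contradiction (≤-trans (∈E⇒proj-mono (All.lookup Es⊆E e∈)) u≤t) w≰t

  Adj-pendant : ∀ {Es p w} → All (_∈ E) Es → Adj Es (pendant p) w → pendantEdge p ∈ Es
  Adj-pendant       Es⊆E (inj₁ e∈) = contradiction refl (pendant≢spine (∈E⇒tail≤n (All.lookup Es⊆E e∈)))
  Adj-pendant {Es} Es⊆E (inj₂ e∈) = subst (_∈ Es) (∈E-pendantHead (All.lookup Es⊆E e∈) refl) e∈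

  lo hi : List ℕ → ℕ
  lo []       = n
  lo (v ∷ vs) = proj v ⊓ lo vs
  hi []       = 0
  hi (v ∷ vs) = proj v ⊔ hi vs

  lo-≤ : ∀ {v S} → v ∈ S → lo S ≤ proj v
  lo-≤ (here refl) = m⊓n≤m _ _
  lo-≤ (there v∈)  = ≤-trans (m⊓n≤n _ _) (lo-≤ v∈)

  ≤-hi : ∀ {v S} → v ∈ S → proj v ≤ hi S
  ≤-hi (here refl) = m≤m⊔n _ _
  ≤-hi (there v∈)  = ≤-trans (≤-hi v∈) (m≤n⊔m _ _)

  hi≤n : ∀ S → hi S ≤ n
  hi≤n []      = z≤n
  hi≤n (v ∷ S) = ⊔-lub (proj≤n v) (hi≤n S)

  lo-attained : ∀ x xs → ∃[ u ] u ∈ x ∷ xs × proj u ≡ lo (x ∷ xs)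
  lo-attained x []       = x , here refl , sym (m≤n⇒m⊓n≡m (proj≤n x))
  lo-attained x (y ∷ ys) with ⊓-sel (proj x) (lo (y ∷ ys))
  ... | inj₁ eq = x , here refl , sym eq
  ... | inj₂ eq with u , u∈ , pu ← lo-attained y ys = u , there u∈ , trans pu (sym eq)

  hi-attained : ∀ x xs → ∃[ v ] v ∈ x ∷ xs × proj v ≡ hi (x ∷ xs)
  hi-attained x []       = x , here refl , sym (⊔-identityʳ (proj x))
  hi-attained x (y ∷ ys) with ⊔-sel (proj x) (hi (y ∷ ys))
  ... | inj₁ eq = x , here refl , sym eq
  ... | inj₂ eq with v , v∈ , pv ← hi-attained y ys = v , there v∈ , trans pv (sym eq)

  pendantsIn : List ℕ → List (Fin m)
  pendantsIn S = filter (λ p → pendant p ∈? S) (allFin m)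

  #pendants : List ℕ → ℕ
  #pendants S = length (pendantsIn S)

  ∈-pendantsIn⁺ : ∀ {S p} → pendant p ∈ S → p ∈ pendantsIn S
  ∈-pendantsIn⁺ {S} {p} = ∈-filter⁺ (λ p → pendant p ∈? S) (∈-allFin p)

  ∈-pendantsIn⁻ : ∀ {S p} → p ∈ pendantsIn S → pendant p ∈ S
  ∈-pendantsIn⁻ {S} = proj₂ ∘ ∈-filter⁻ (λ p → pendant p ∈? S) {xs = allFin m}

  #pendants-replaceSpine : ∀ xs ys {a b} → a ≤ n → b ≤ n →
    #pendants (xs ++ a ∷ ys) ≡ #pendants (xs ++ b ∷ ys)
  #pendants-replaceSpine xs ys a≤n b≤n = cong length (filter-≐ _ _
    ((∈-++-replace xs (pendant≢spine a≤n)) , (∈-++-replace xs (pendant≢spine b≤n))) (allFin m))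

  steinerEdges : List ℕ → List Edge
  steinerEdges S = spineEdges (lo S) (hi S) ++ map pendantEdge (pendantsIn S)

  steinerVertices : List ℕ → List ℕ
  steinerVertices S = spineSegment (lo S) (hi S) ++ map pendant (pendantsIn S)

  All-steinerEdges⁺ : ∀ {P : Edge → Set} S →
    (∀ {t} → lo S ≤ t → t < hi S → P (spineEdge t)) → (∀ {p} → pendant p ∈ S → P (pendantEdge p)) →
    All P (steinerEdges S)
  All-steinerEdges⁺ S P-spine P-pendant =
    All.++⁺ (All-spineEdges⁺ P-spine) (All.map⁺ (All.tabulate (P-pendant ∘ ∈-pendantsIn⁻)))

  All-steinerVertices⁺ : ∀ {P : ℕ → Set} S → lo S ≤ hi S →
    (∀ {v} → lo S ≤ v → v ≤ hi S → P v) → (∀ {p} → pendant p ∈ S → P (pendant p)) →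
    All P (steinerVertices S)
  All-steinerVertices⁺ S lo≤hi P-spine P-pendant =
    All.++⁺ (All-spineSegment⁺ lo≤hi P-spine) (All.map⁺ (All.tabulate (P-pendant ∘ ∈-pendantsIn⁻)))

  length-steinerEdges : ∀ S → length (steinerEdges S) ≡ hi S ∸ lo S + #pendants S
  length-steinerEdges S = trans (length-++ (spineEdges (lo S) (hi S)))
    (cong₂ _+_ (length-applyUpTo _ _) (length-map pendantEdge (pendantsIn S)))

  steinerEdges-unique : ∀ S → Unique (steinerEdges S)
  steinerEdges-unique S = Unique.++⁺ (spineEdges-unique (lo S) (hi S))
    (Unique.map⁺ (pendant-injective ∘ cong proj₂) (Unique.filter⁺ _ (Unique.allFin⁺ m))) disjoint
    where
    heads≤n : All (λ e → proj₂ e ≤ n) (spineEdges (lo S) (hi S))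
    heads≤n = All-spineEdges⁺ λ _ t<hi → ≤-trans t<hi (hi≤n S)
    disjoint : ∀ {e} → ¬ (e ∈ spineEdges (lo S) (hi S) × e ∈ map pendantEdge (pendantsIn S))
    disjoint (e∈spine , e∈pendant) with p , _ , refl ← ∈-map⁻ pendantEdge e∈pendant =
      <⇒≱ (n<pendant p) (All.lookup heads≤n e∈spine)

  steinerEdges-⊆ : ∀ {Es y₁ y₂ rest} → y₁ ≢ y₂ → All (_∈ E) Es →
    Connected Es (y₁ ∷ y₂ ∷ rest) → All (_∈ Es) (steinerEdges (y₁ ∷ y₂ ∷ rest))
  steinerEdges-⊆ {Es} {y₁} {y₂} {rest} y₁≢y₂ Es⊆E connected = All-steinerEdges⁺ S crossed leafEdge
    where
    S = y₁ ∷ y₂ ∷ rest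
    crossed : ∀ {t} → lo S ≤ t → t < hi S → spineEdge t ∈ Es
    crossed {t} lo≤t t<hi
      with u , u∈ , proj-u ← lo-attained y₁ (y₂ ∷ rest)
         | v , v∈ , proj-v ← hi-attained y₁ (y₂ ∷ rest) =
      Reach-crossing Es⊆E (connected u∈ v∈)
        (subst (_≤ t) (sym proj-u) lo≤t) (subst (t <_) (sym proj-v) t<hi)
    another : ∀ v → ∃[ w ] w ∈ S × v ≢ w
    another v with v ≟ y₁
    ... | yes refl = y₂ , there (here refl) , y₁≢y₂
    ... | no  v≢y₁ = y₁ , here refl , v≢y₁
    leafEdge : ∀ {p} → pendant p ∈ S → pendantEdge p ∈ Es
    leafEdge {p} p∈ with w , w∈ , p≢w ← another (pendant p) =
      Adj-pendant Es⊆E (proj₂ (Reach-first (connected p∈ w∈) p≢w))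

  steinerEdges-minimal : ∀ {y₁ y₂ rest ℓ} → y₁ ≢ y₂ → ConnSub n m att (y₁ ∷ y₂ ∷ rest) ℓ →
    length (steinerEdges (y₁ ∷ y₂ ∷ rest)) ≤ ℓ
  steinerEdges-minimal y₁≢y₂ (_ , _ , _ , _ , Es⊆E , _ , connected , S⊆Vs , refl) =
    Unique-⊆⇒length≤ (steinerEdges-unique _)
      (All.lookup (steinerEdges-⊆ y₁≢y₂ Es⊆E λ u∈ v∈ →
        connected _ _ (All.lookup S⊆Vs u∈) (All.lookup S⊆Vs v∈)))

  steinerTree : ∀ {x xs} → All (IsVertex n m) (x ∷ xs) →
    ConnSub n m att (x ∷ xs) (length (steinerEdges (x ∷ xs)))
  steinerTree {x} {xs} S⊆V =
    steinerVertices S , steinerEdges S , vertices , steinerEdges-unique S , edges , ends ,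
    (λ u v u∈ v∈ → Reach-trans (All.lookup toLo u∈) (Reach-sym (All.lookup toLo v∈))) ,
    covered , refl
    where
    S = x ∷ xs
    lo≤hi : lo S ≤ hi S
    lo≤hi = ≤-trans (lo-≤ {S = S} (here refl)) (≤-hi {S = S} (here refl))
    onSpine : ∀ {v} → lo S ≤ v → v ≤ hi S → v ∈ steinerVertices S
    onSpine lo≤v v≤hi = ∈-++⁺ˡ (∈-spineSegment⁺ lo≤v v≤hi)
    pendant∈ : ∀ {p} → pendant p ∈ S → pendant p ∈ steinerVertices S
    pendant∈ p∈ = ∈-++⁺ʳ _ (∈-map⁺ pendant (∈-pendantsIn⁺ p∈))
    attached : ∀ {p} → pendant p ∈ S → lo S ≤ att p × att p ≤ hi S
    attached {p} p∈ =
      subst (lo S ≤_) (proj-pendant p) (lo-≤ p∈) , subst (_≤ hi S) (proj-pendant p) (≤-hi p∈)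
    vertices : All (IsVertex n m) (steinerVertices S)
    vertices = All-steinerVertices⁺ S lo≤hi (λ _ v≤hi → ≤-trans v≤hi (≤-trans (hi≤n S) (m≤m+n n m)))
      λ {p} _ → pendant-vertex p
    edges : All (_∈ E) (steinerEdges S)
    edges = All-steinerEdges⁺ S (λ _ t<hi → spineEdge∈E (<-≤-trans t<hi (hi≤n S)))
      λ {p} _ → pendantEdge∈E p
    ends : All (λ e → proj₁ e ∈ steinerVertices S × proj₂ e ∈ steinerVertices S) (steinerEdges S)
    ends = All-steinerEdges⁺ S
      (λ {t} lo≤t t<hi → onSpine lo≤t (<⇒≤ t<hi) , onSpine (≤-trans lo≤t (n≤1+n t)) t<hi)
      λ p∈ → onSpine (proj₁ (attached p∈)) (proj₂ (attached p∈)) , pendant∈ p∈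
    alongSpine : ∀ {v} → lo S ≤ v → v ≤ hi S → Reach (steinerEdges S) v (lo S)
    alongSpine {v} lo≤v v≤hi = Reach-mono ∈-++⁺ˡ (spineEdges-reach v lo≤v v≤hi)
    toLo : All (λ v → Reach (steinerEdges S) v (lo S)) (steinerVertices S)
    toLo = All-steinerVertices⁺ S lo≤hi alongSpine λ p∈ →
      step (inj₂ (∈-++⁺ʳ _ (∈-map⁺ pendantEdge (∈-pendantsIn⁺ p∈))))
        (alongSpine (proj₁ (attached p∈)) (proj₂ (attached p∈)))
    covered : All (_∈ steinerVertices S) S
    covered = All.tabulate λ {v} v∈ →
      [ (λ v≤n → onSpine (subst (lo S ≤_) (proj-spine v≤n) (lo-≤ v∈)) (subst (_≤ hi S) (proj-spine v≤n) (≤-hi v∈)))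
      , (λ { (p , refl) → pendant∈ v∈ })
      ]′ (vertex-cases (All.lookup S⊆V v∈))

  steinerDist≡ : ∀ {y₁ y₂ rest d} → y₁ ≢ y₂ → All (IsVertex n m) (y₁ ∷ y₂ ∷ rest) →
    SteinerDist n m att (y₁ ∷ y₂ ∷ rest) d →
    d ≡ hi (y₁ ∷ y₂ ∷ rest) ∸ lo (y₁ ∷ y₂ ∷ rest) + #pendants (y₁ ∷ y₂ ∷ rest)
  steinerDist≡ y₁≢y₂ S⊆V (tree , minimal) =
    trans (≤-antisym (minimal _ (steinerTree S⊆V)) (steinerEdges-minimal y₁≢y₂ tree))
          (length-steinerEdges _)

  steinerDist-quadruple : ∀ {y₁ y₂ a b d} → y₁ ≢ y₂ → All (IsVertex n m) (y₁ ∷ y₂ ∷ a ∷ b ∷ []) →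
    SteinerDist n m att (y₁ ∷ y₂ ∷ a ∷ b ∷ []) d →
    d ≡ extent (proj y₁ ⊓ proj y₂) (proj y₁ ⊔ proj y₂) (proj a) (proj b)
        + #pendants (y₁ ∷ y₂ ∷ a ∷ b ∷ [])
  steinerDist-quadruple {y₁} {y₂} {a} {b} y₁≢y₂ S⊆V dist =
    trans (steinerDist≡ y₁≢y₂ S⊆V dist)
          (cong (_+ #pendants (y₁ ∷ y₂ ∷ a ∷ b ∷ [])) (cong₂ _∸_ hi≡ lo≡))
    where
    hi≡ : proj y₁ ⊔ (proj y₂ ⊔ (proj a ⊔ (proj b ⊔ 0))) ≡ (proj y₁ ⊔ proj y₂) ⊔ (proj a ⊔ proj b)
    hi≡ = trans (cong (λ x → proj y₁ ⊔ (proj y₂ ⊔ (proj a ⊔ x))) (⊔-identityʳ (proj b)))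
                (sym (⊔-assoc (proj y₁) (proj y₂) _))
    lo≡ : proj y₁ ⊓ (proj y₂ ⊓ (proj a ⊓ (proj b ⊓ n))) ≡ (proj y₁ ⊓ proj y₂) ⊓ (proj a ⊓ proj b)
    lo≡ = trans (cong (λ x → proj y₁ ⊓ (proj y₂ ⊓ (proj a ⊓ x))) (m≤n⇒m⊓n≡m (proj≤n b)))
                (sym (⊓-assoc (proj y₁) (proj y₂) _))

  proj-pendantNeighbour : ∀ {i j} → n < j → Adj E i j → proj j ≡ i
  proj-pendantNeighbour n<j (inj₂ e∈E) = contradiction (∈E⇒tail≤n e∈E) (<⇒≱ n<j)
  proj-pendantNeighbour n<j (inj₁ e∈E) with ∈E-cases e∈E
  ... | inj₁ (_ , t<n , refl) = contradiction t<n (<⇒≱ n<j)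
  ... | inj₂ (p , refl)       = proj-pendant p

mainTheorem9 : (n m : ℕ) (att : Fin m → ℕ) →
    (∀ p → att p ≤ n) →
    (∀ ps → IsPath n m att ps → length ps ≤ suc n) →
    (k j i : ℕ) → 0 < k → k ≤ n → n < j → j ≤ n + m →
    i ≤ n → Adj (catEdges n m att) i j →
    ¬ InX n m att k j → i ≤ k →
    (y₁ y₂ : ℕ) → y₁ ≢ y₂ → IsVertex n m y₁ → IsVertex n m y₂ →
    (d₁ d₂ d₃ d₄ d₅ d₆ : ℕ) →
    SteinerDist n m att (y₁ ∷ y₂ ∷ k ∷ j ∷ []) d₁ →
    SteinerDist n m att (y₁ ∷ y₂ ∷ 0 ∷ j ∷ []) d₂ →
    SteinerDist n m att (y₁ ∷ y₂ ∷ 0 ∷ n ∷ []) d₃ →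
    SteinerDist n m att (y₁ ∷ y₂ ∷ i ∷ n ∷ []) d₄ →
    SteinerDist n m att (y₁ ∷ y₂ ∷ 0 ∷ k ∷ []) d₅ →
    SteinerDist n m att (y₁ ∷ y₂ ∷ 0 ∷ i ∷ []) d₆ →
    + d₁ ≡ ((((+ d₂ - + d₃) +ℤ + d₄) +ℤ + d₅) - + d₆)
mainTheorem9 n m att att≤n _ k j i _ k≤n n<j j≤n+m i≤n i~j _ i≤k
             y₁ y₂ y₁≢y₂ y₁-vertex y₂-vertex _ _ _ _ _ _ s₁ s₂ s₃ s₄ s₅ s₆ =
  column-combination {σ₁ = σ k i} {σ₃ = σ 0 n} {σ₄ = σ i n} {σ₅ = σ 0 k} {τ = σ 0 i}
                     {c = #pendants (y₁ ∷ y₂ ∷ 0 ∷ n ∷ [])} {c′ = #pendants (y₁ ∷ y₂ ∷ k ∷ j ∷ [])}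
    (distance (spine k≤n) j≤n+m (proj-spine k≤n) proj-j refl s₁)
    (distance (spine z≤n) j≤n+m refl proj-j
      (#pendants-replaceSpine (y₁ ∷ y₂ ∷ []) (j ∷ []) z≤n k≤n) s₂)
    (distance (spine z≤n) (spine ≤-refl) refl (proj-spine ≤-refl) refl s₃)
    (distance (spine i≤n) (spine ≤-refl) (proj-spine i≤n) (proj-spine ≤-refl)
      (#pendants-replaceSpine (y₁ ∷ y₂ ∷ []) (n ∷ []) i≤n z≤n) s₄)
    (distance (spine z≤n) (spine k≤n) refl (proj-spine k≤n)
      (#pendants-replaceSpine (y₁ ∷ y₂ ∷ 0 ∷ []) [] k≤n ≤-refl) s₅)
    (distance (spine z≤n) (spine i≤n) refl (proj-spine i≤n)
      (#pendants-replaceSpine (y₁ ∷ y₂ ∷ 0 ∷ []) [] i≤n ≤-refl) s₆)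
    (extent-exchange A B i≤k k≤n (⊔-lub (proj≤n y₁) (proj≤n y₂)))
  where
  open Caterpillar n m att att≤n
  A B : ℕ
  A = proj y₁ ⊓ proj y₂
  B = proj y₁ ⊔ proj y₂
  σ : ℕ → ℕ → ℕ
  σ = extent A B
  spine : ∀ {v} → v ≤ n → IsVertex n m v
  spine v≤n = ≤-trans v≤n (m≤m+n n m)
  proj-j : proj j ≡ i
  proj-j = proj-pendantNeighbour n<j i~j
  distance : ∀ {a b a′ b′ c d} → IsVertex n m a → IsVertex n m b → proj a ≡ a′ → proj b ≡ b′ →
    #pendants (y₁ ∷ y₂ ∷ a ∷ b ∷ []) ≡ c → SteinerDist n m att (y₁ ∷ y₂ ∷ a ∷ b ∷ []) d →
    d ≡ σ a′ b′ + c
  distance a-vertex b-vertex refl refl refl =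
    steinerDist-quadruple y₁≢y₂ (y₁-vertex ∷ y₂-vertex ∷ a-vertex ∷ b-vertex ∷ [])
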